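{- Let $K$ be a field of characteristic zero (e.g. $K=\mathbb{C}$ or $\mathbb{C}_p$) and $D=\frac{d}{dt}$. Let $m\ge 2$ and $T,Q_1,\dots,Q_m\in K[t]$ with $S'=\deg T$, $r'_j=\deg Q_j$ (degree of the zero polynomial being $-\infty$), and assume either $$S'\ge 0,\qquad r'_m=S'+1,\qquad r'_j<r'_m\ \text{ for all } j=1,\dots,m-1,$$ or $$r'_m\ge 0,\qquad S'=r'_m+1,\qquad r'_j\le r'_m\ \text{ for all } j=1,\dots,m.$$ Then the differential operator $$E(D,t)=TD^m-Q_1D^{m-1}-\dots-Q_m$$ (corresponding to the equation $TD^mF=Q_1D^{m-1}F+\dots+Q_mD^0F$) is irreducible in the ring $K(t)[D]$ of differential operators.
   Context: A nonzero operator in the ring of differential operators $K(t)[D]$ is irreducible if it cannot be written as a product of two operators in that ring each of order strictly smaller than its own order. -}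

module Defs where

open import Level using (Level; _⊔_) renaming (suc to lsuc)
open import Algebra.Bundles using (CommutativeRing)
open import Data.Nat using (ℕ; zero; suc; _<_; _≤_)
open import Data.Fin using (Fin; toℕ; opposite)
open import Data.List using (List; []; _∷_; map; _++_; [_]; allFin)
open import Data.Product using (Σ; ∃; _×_; _,_)
open import Data.Empty using (⊥)
open import Relation.Nullary using (¬_)

record Field (c ℓ : Level) : Set (lsuc (c ⊔ ℓ)) where
  field
    commutativeRing : CommutativeRing c ℓ
  open CommutativeRing commutativeRing public
  field
    1≉0     : ¬ (1# ≈ 0#)
    inverse : ∀ x → ¬ (x ≈ 0#) → ∃ λ y → x * y ≈ 1#

module FieldTheory {c ℓ : Level} (K : Field c ℓ) where
  open Field K

  fromℕ : ℕ → Carrier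
  fromℕ zero    = 0#
  fromℕ (suc n) = 1# + fromℕ n

  CharZero : Set ℓ
  CharZero = ∀ n → ¬ (fromℕ (suc n) ≈ 0#)

  -- Polynomials K[t]: coefficient lists, constant term first.
  -- (Trailing zero coefficients are allowed; all notions below are
  -- invariant under them.)

  Poly : Set c
  Poly = List Carrier

  coeff : Poly → ℕ → Carrier
  coeff []       _       = 0#
  coeff (a ∷ p)  zero    = a
  coeff (a ∷ p)  (suc k) = coeff p k

  _≈P_ : Poly → Poly → Set ℓ
  p ≈P q = ∀ k → coeff p k ≈ coeff q k

  IsZeroP : Poly → Set ℓ
  IsZeroP p = ∀ k → coeff p k ≈ 0#

  constP : Carrier → Poly
  constP a = a ∷ []

  _+P_ : Poly → Poly → Poly
  []      +P q       = q
  (a ∷ p) +P []      = a ∷ p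
  (a ∷ p) +P (b ∷ q) = (a + b) ∷ (p +P q)

  negP : Poly → Poly
  negP = map (-_)

  scaleP : Carrier → Poly → Poly
  scaleP a = map (a *_)

  _*P_ : Poly → Poly → Poly
  []      *P q = []
  (a ∷ p) *P q = scaleP a q +P (0# ∷ (p *P q))

  derivAux : ℕ → Poly → Poly
  derivAux n []      = []
  derivAux n (a ∷ p) = (fromℕ n * a) ∷ derivAux (suc n) p

  derivP : Poly → Poly
  derivP []      = []
  derivP (a ∷ p) = derivAux 1 p

  DegEq : Poly → ℕ → Set ℓ
  DegEq p d = ¬ (coeff p d ≈ 0#) × (∀ k → d < k → coeff p k ≈ 0#)

  -- deg p < d, where deg 0 = -∞ (so the zero polynomial satisfies it)
  DegLt : Poly → ℕ → Set ℓ
  DegLt p d = ∀ k → d ≤ k → coeff p k ≈ 0#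

  -- Rational functions K(t): fractions num/den, with the usual
  -- equivalence num₁·den₂ = num₂·den₁.  Well-formedness (den ≠ 0) is a
  -- separate predicate, imposed on all operators that are quantified over.

  record Frac : Set c where
    constructor _/_
    field
      num : Poly
      den : Poly
  open Frac public

  WFFrac : Frac → Set ℓ
  WFFrac f = ¬ IsZeroP (den f)

  _≈F_ : Frac → Frac → Set ℓ
  f ≈F g = (num f *P den g) ≈P (num g *P den f)

  IsZeroF : Frac → Set ℓ
  IsZeroF f = IsZeroP (num f)

  polyF : Poly → Frac
  polyF p = p / constP 1#

  0F : Frac
  0F = polyF []

  _+F_ : Frac → Frac → Frac
  (a / b) +F (c' / d) = ((a *P d) +P (c' *P b)) / (b *P d)

  _*F_ : Frac → Frac → Frac
  (a / b) *F (c' / d) = (a *P c') / (b *P d)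

  derivF : Frac → Frac
  derivF (a / b) = ((derivP a *P b) +P negP (a *P derivP b)) / (b *P b)

  -- Differential operators K(t)[D], D = d/dt: lists of coefficients
  -- a₀, a₁, …, representing Σ aᵢ Dⁱ, with D·f = f·D + f'.

  Op : Set c
  Op = List Frac

  coeffOp : Op → ℕ → Frac
  coeffOp []      _       = 0F
  coeffOp (a ∷ A) zero    = a
  coeffOp (a ∷ A) (suc k) = coeffOp A k

  WFOp : Op → Set ℓ
  WFOp A = ∀ k → WFFrac (coeffOp A k)

  _≈Op_ : Op → Op → Set ℓ
  A ≈Op B = ∀ k → coeffOp A k ≈F coeffOp B k

  _+Op_ : Op → Op → Op
  []      +Op B       = B
  (a ∷ A) +Op []      = a ∷ A
  (a ∷ A) +Op (b ∷ B) = (a +F b) ∷ (A +Op B)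

  scaleOp : Frac → Op → Op
  scaleOp f = map (f *F_)

  -- left multiplication by D:  D · Σ bⱼ Dʲ = Σ (bⱼ Dʲ⁺¹ + bⱼ' Dʲ)
  DOp : Op → Op
  DOp B = (0F ∷ B) +Op map derivF B

  -- product in K(t)[D]:  (a₀ + A'·D)·B = a₀·B + A'·(D·B)
  _*Op_ : Op → Op → Op
  []      *Op B = []
  (a ∷ A) *Op B = scaleOp a B +Op (A *Op DOp B)

  IsZeroOp : Op → Set ℓ
  IsZeroOp A = ∀ k → IsZeroF (coeffOp A k)

  OrdEq : Op → ℕ → Set ℓ
  OrdEq A d = ¬ IsZeroF (coeffOp A d) × (∀ k → d < k → IsZeroF (coeffOp A k))

  -- ord A < d  (the zero operator has order -∞)
  OrdLt : Op → ℕ → Set ℓ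
  OrdLt A d = ∀ k → d ≤ k → IsZeroF (coeffOp A k)

  Irreducible : Op → Set (c ⊔ ℓ)
  Irreducible L =
    (¬ IsZeroOp L) ×
    (∀ d → OrdEq L d → ∀ A B → WFOp A → WFOp B →
       OrdLt A d → OrdLt B d → (A *Op B) ≈Op L → ⊥)

  -- E(D,t) = T Dᵐ - Q₁ Dᵐ⁻¹ - … - Qₘ, with Q j standing for Q_{j+1}
  -- (j : Fin m).  The coefficient of Dⁱ (i < m) is -Q_{m-i} = -(Q (opposite i)).

  opE : (m : ℕ) → Poly → (Fin m → Poly) → Op
  opE m T Q = map (λ i → polyF (negP (Q (opposite i)))) (allFin m) ++ [ polyF T ]

{-# OPTIONS --safe #-}
-- Give t the weight m and D the weight ε, with ε = 1 in the first case and ε = −1 in the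
-- second, so that (tᵃ/tᵈ)·Dᵏ weighs m(a − d) + εk. Every coefficient of E then weighs at most
-- M = m·deg Q_m, with equality exactly at D⁰ and at Dᵐ. Weights add under
-- multiplication, and the correction f′ in D·f = f·D + f′ is strictly lighter because
-- m ≥ 1 − ε; hence a product of two operators that each have a unique heaviest coefficient
-- again has one. Since |ε| = 1, nonzero coefficients whose orders differ by less than m have
-- different weights, so every nonzero operator of order < m has a unique heaviest
-- coefficient, and a product of two of them cannot equal E.
-- Whether a coefficient is zero is undecidable in K, so degrees are only obtained inside the
-- double-negation monad, which suffices because the goal is ⊥.
module Submission where

open import Defs
open import Level using (Level)
open import Data.Nat using (ℕ)
import Data.Nat as ℕ
import Data.Nat.Properties as ℕP
open import Data.Integer as ℤ using (ℤ; +_)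
import Data.Integer.Properties as ℤP
open import Data.Integer.Tactic.RingSolver using (solve-∀)
open import Data.Product using (Σ; ∃; _×_; _,_; proj₁; proj₂)
open import Function using (id)
open import Data.Sum using (_⊎_; inj₁; inj₂)
open import Data.Empty using (⊥; ⊥-elim)
open import Relation.Nullary using (¬_; yes; no)
open import Relation.Nullary.Negation using (¬¬-Monad)
open import Relation.Nullary.Decidable using (¬¬-excluded-middle)
open import Effect.Monad using (RawMonad)
open import Relation.Binary using (tri<; tri≈; tri>)
open import Data.List using ([]; _∷_; map; _++_; [_]; tabulate)
import Data.List.Properties as List
open import Data.Fin as Fin using (Fin; toℕ; fromℕ<; opposite)
import Data.Fin.Properties as FinP
import Relation.Binary.PropositionalEquality as ≡
open ≡ using (_≡_; _≢_; module ≡-Reasoning)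

module IntegerOrder where
  open import Data.Integer using (_+_; _-_; -_; _<_; _≤_; pred; -1ℤ)

  +-cancelʳ-< : ∀ {i j} k → i + k < j + k → i < j
  +-cancelʳ-< {i} {j} k i+k<j+k =
    ≡.subst₂ _<_ (i+k-k≡i i k) (i+k-k≡i j k) (ℤP.+-monoˡ-< (- k) i+k<j+k)
    where
    i+k-k≡i : ∀ i k → i + k - k ≡ i
    i+k-k≡i = solve-∀

  i-k<j⇒i<j+k : ∀ {i j} k → i - k < j → i < j + k
  i-k<j⇒i<j+k {i} k i-k<j = ≡.subst (_< _) (i-k+k≡i i k) (ℤP.+-monoˡ-< k i-k<j)
    where
    i-k+k≡i : ∀ i k → i - k + k ≡ i
    i-k+k≡i = solve-∀

  +-<-split : ∀ {a b i j} → a + b < i + j → a < i ⊎ b < j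
  +-<-split {a} {b} {i} {j} a+b<i+j with a ℤP.<? i | b ℤP.<? j
  ... | yes a<i | _       = inj₁ a<i
  ... | no _    | yes b<j = inj₂ b<j
  ... | no a≮i  | no b≮j  = ⊥-elim (ℤP.<⇒≱ a+b<i+j (ℤP.+-mono-≤ (ℤP.≮⇒≥ a≮i) (ℤP.≮⇒≥ b≮j)))

  pred<self : ∀ i → pred i < i
  pred<self i = ℤP.i≤pred[j]⇒i<j ℤP.≤-refl

  -[m]<1 : ∀ m → - + m < + 1
  -[m]<1 m = ℤP.≤-<-trans (ℤP.neg-mono-≤ (ℤ.+≤+ ℕ.z≤n)) (ℤ.+<+ (ℕ.s≤s ℕ.z≤n))

  -[m]<-1 : ∀ {m} → 2 ℕ.≤ m → - + m < -1ℤ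
  -[m]<-1 (ℕ.s≤s (ℕ.s≤s ℕ.z≤n)) = ℤ.-<- (ℕ.s≤s ℕ.z≤n)

open IntegerOrder

module Weight (m : ℕ) (ε : ℤ) where
  open import Data.Integer using (_+_; _-_; _*_; ∣_∣; _≤_)

  weight : ℕ → ℕ → ℕ → ℤ
  weight a d k = + m * (+ a - + d) + ε * + k

  weight-suc-order : ∀ a d k → weight a d (ℕ.suc k) ≡ weight a d k + ε
  weight-suc-order a d k = lemma (+ m) ε (+ a) (+ d) (+ k)
    where
    lemma : ∀ M E A D K → M * (A - D) + E * (+ 1 + K) ≡ M * (A - D) + E * K + E
    lemma = solve-∀

  weight-suc-num : ∀ a d k → weight (ℕ.suc a) d k ≡ weight a d k + + m
  weight-suc-num a d k = lemma (+ m) ε (+ a) (+ d) (+ k)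
    where
    lemma : ∀ M E A D K → M * ((+ 1 + A) - D) + E * K ≡ M * (A - D) + E * K + M
    lemma = solve-∀

  weight-+ : ∀ a b d e k → weight (a ℕ.+ b) (d ℕ.+ e) k ≡ weight a d 0 + weight b e k
  weight-+ a b d e k rewrite ℤP.pos-+ a b | ℤP.pos-+ d e =
    lemma (+ m) ε (+ a) (+ b) (+ d) (+ e) (+ k)
    where
    lemma : ∀ M E A B D E' K →
            M * ((A + B) - (D + E')) + E * K ≡ (M * (A - D) + E * + 0) + (M * (B - E') + E * K)
    lemma = solve-∀

  weight-+num : ∀ a d n k → weight (a ℕ.+ n) d k ≡ weight a d k + + (m ℕ.* n)
  weight-+num a d n k rewrite ℤP.pos-+ a n | ℤP.pos-* m n =
    lemma (+ m) ε (+ a) (+ d) (+ n) (+ k)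
    where
    lemma : ∀ M E A D N K → M * ((A + N) - D) + E * K ≡ M * (A - D) + E * K + M * N
    lemma = solve-∀

  weight-cancel : ∀ a d x k → weight (a ℕ.+ x) (d ℕ.+ x) k ≡ weight a d k
  weight-cancel a d x k rewrite ℤP.pos-+ a x | ℤP.pos-+ d x =
    lemma (+ m) ε (+ a) (+ d) (+ x) (+ k)
    where
    lemma : ∀ M E A D X K → M * ((A + X) - (D + X)) + E * K ≡ M * (A - D) + E * K
    lemma = solve-∀

  weight-mono : ∀ a d a′ d′ k → a ℕ.+ d′ ℕ.≤ a′ ℕ.+ d → weight a d k ≤ weight a′ d′ k
  weight-mono a d a′ d′ k le with ℕP.m≤n⇒∃[o]m+o≡n le
  ... | n , a+d′+n≡a′+d = ≡.subst (weight a d k ≤_) (≡.sym weight′) (ℤP.i≤i+j (weight a d k) (+ (m ℕ.* n)))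
    where
    open ≡-Reasoning
    weight′ : weight a′ d′ k ≡ weight a d k + + (m ℕ.* n)
    weight′ = begin
      weight a′ d′ k                            ≡⟨ weight-cancel a′ d′ d k ⟨
      weight (a′ ℕ.+ d) (d′ ℕ.+ d) k            ≡⟨ ≡.cong₂ (λ u v → weight u v k) (≡.sym a+d′+n≡a′+d) (ℕP.+-comm d′ d) ⟩
      weight (a ℕ.+ d′ ℕ.+ n) (d ℕ.+ d′) k      ≡⟨ weight-+num (a ℕ.+ d′) (d ℕ.+ d′) n k ⟩
      weight (a ℕ.+ d′) (d ℕ.+ d′) k + + (m ℕ.* n) ≡⟨ ≡.cong (_+ + (m ℕ.* n)) (weight-cancel a d d′ k) ⟩
      weight a d k + + (m ℕ.* n)                ∎

  weight-mono-order : ∀ a d k k′ → ε * + k ≤ ε * + k′ → weight a d k ≤ weight a d k′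
  weight-mono-order a d k k′ εk≤εk′ = ℤP.+-monoʳ-≤ (+ m * (+ a - + d)) εk≤εk′

  weight-≤-dropʳ : ∀ {i l j} d₁ d₂ k → i ℕ.+ l ≡ j → l ℕ.≤ d₂ → weight j (d₁ ℕ.+ d₂) k ≤ weight i d₁ k
  weight-≤-dropʳ {i} {l} d₁ d₂ k ≡.refl l≤d₂ = weight-mono (i ℕ.+ l) (d₁ ℕ.+ d₂) i d₁ k (begin
    i ℕ.+ l ℕ.+ d₁     ≡⟨ ℕP.+-assoc i l d₁ ⟩
    i ℕ.+ (l ℕ.+ d₁)   ≡⟨ ≡.cong (i ℕ.+_) (ℕP.+-comm l d₁) ⟩
    i ℕ.+ (d₁ ℕ.+ l)   ≤⟨ ℕP.+-monoʳ-≤ i (ℕP.+-monoʳ-≤ d₁ l≤d₂) ⟩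
    i ℕ.+ (d₁ ℕ.+ d₂)  ∎)
    where open ℕP.≤-Reasoning

  weight-separates-orders : ∣ ε ∣ ≡ 1 → ∀ a d a′ d′ k t → ℕ.suc t ℕ.< m →
                            weight a d k ≢ weight a′ d′ (k ℕ.+ ℕ.suc t)
  weight-separates-orders ∣ε∣≡1 a d a′ d′ k t 1+t<m eq = m∤1+t ∣ X ∣ m*∣X∣≡1+t
    where
    open ≡-Reasoning
    X = (+ a - + d) - (+ a′ - + d′)
    lemma₁ : ∀ M E A D A′ D′ K → M * ((A - D) - (A′ - D′)) ≡ (M * (A - D) + E * K) - (M * (A′ - D′) + E * K)
    lemma₁ = solve-∀
    lemma₂ : ∀ M E A′ D′ K S → (M * (A′ - D′) + E * (K + S)) - (M * (A′ - D′) + E * K) ≡ E * S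
    lemma₂ = solve-∀
    m*X≡ε*[1+t] : + m * X ≡ ε * + ℕ.suc t
    m*X≡ε*[1+t] = begin
      + m * X                                       ≡⟨ lemma₁ (+ m) ε (+ a) (+ d) (+ a′) (+ d′) (+ k) ⟩
      weight a d k - weight a′ d′ k                 ≡⟨ ≡.cong (_- weight a′ d′ k) eq ⟩
      weight a′ d′ (k ℕ.+ ℕ.suc t) - weight a′ d′ k  ≡⟨ ≡.cong (λ z → (+ m * (+ a′ - + d′) + ε * z) - weight a′ d′ k)
                                                             (ℤP.pos-+ k (ℕ.suc t)) ⟩
      (+ m * (+ a′ - + d′) + ε * (+ k + + ℕ.suc t)) - weight a′ d′ k
                                                    ≡⟨ lemma₂ (+ m) ε (+ a′) (+ d′) (+ k) (+ ℕ.suc t) ⟩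
      ε * + ℕ.suc t                                 ∎
    m*∣X∣≡1+t : m ℕ.* ∣ X ∣ ≡ ℕ.suc t
    m*∣X∣≡1+t = begin
      m ℕ.* ∣ X ∣          ≡⟨ ℤP.abs-* (+ m) X ⟨
      ∣ + m * X ∣         ≡⟨ ≡.cong ∣_∣ m*X≡ε*[1+t] ⟩
      ∣ ε * + ℕ.suc t ∣   ≡⟨ ℤP.abs-* ε (+ ℕ.suc t) ⟩
      ∣ ε ∣ ℕ.* ℕ.suc t    ≡⟨ ≡.cong (ℕ._* ℕ.suc t) ∣ε∣≡1 ⟩
      1 ℕ.* ℕ.suc t        ≡⟨ ℕP.*-identityˡ (ℕ.suc t) ⟩
      ℕ.suc t             ∎
    m∤1+t : ∀ x → m ℕ.* x ≢ ℕ.suc t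
    m∤1+t ℕ.zero    eq′ with () ← ≡.trans (≡.sym (ℕP.*-zeroʳ m)) eq′
    m∤1+t (ℕ.suc x) eq′ = ℕP.<⇒≱ 1+t<m (≡.subst (m ℕ.≤_) eq′ (ℕP.m≤m*n m (ℕ.suc x)))

open import Data.Nat using (zero; suc; _∸_; _≤_; _<_; z≤n; s≤s)

module _ {c ℓ : Level} (K : Field c ℓ) where
  open Field K
  open FieldTheory K
  open import Algebra.Properties.Ring ring using (-0#≈0#; -‿involutive)
  open RawMonad (¬¬-Monad {ℓ}) using (pure; _>>=_)

  +-≈0 : ∀ {x y} → x ≈ 0# → y ≈ 0# → x + y ≈ 0#
  +-≈0 x≈0 y≈0 = trans (+-cong x≈0 y≈0) (+-identityˡ 0#)

  *-≈0ˡ : ∀ {x} y → x ≈ 0# → x * y ≈ 0#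
  *-≈0ˡ y x≈0 = trans (*-congʳ x≈0) (zeroˡ y)

  *-≈0ʳ : ∀ x {y} → y ≈ 0# → x * y ≈ 0#
  *-≈0ʳ x y≈0 = trans (*-congˡ y≈0) (zeroʳ x)

  -‿≈0 : ∀ {x} → x ≈ 0# → - x ≈ 0#
  -‿≈0 x≈0 = trans (-‿cong x≈0) -0#≈0#

  *-nonzero : ∀ {x y} → ¬ (x ≈ 0#) → ¬ (y ≈ 0#) → ¬ (x * y ≈ 0#)
  *-nonzero {x} {y} x≉0 y≉0 xy≈0 with inverse x x≉0
  ... | x⁻¹ , xx⁻¹≈1 = y≉0 (begin
    y               ≈⟨ *-identityˡ y ⟨
    1# * y          ≈⟨ *-congʳ (trans (sym xx⁻¹≈1) (*-comm x x⁻¹)) ⟩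
    (x⁻¹ * x) * y   ≈⟨ *-assoc x⁻¹ x y ⟩
    x⁻¹ * (x * y)   ≈⟨ *-≈0ʳ x⁻¹ xy≈0 ⟩
    0#              ∎)
    where open import Relation.Binary.Reasoning.Setoid setoid

  coeff-+P : ∀ p q k → coeff (p +P q) k ≈ coeff p k + coeff q k
  coeff-+P []      q       k       = sym (+-identityˡ _)
  coeff-+P (a ∷ p) []      zero    = sym (+-identityʳ _)
  coeff-+P (a ∷ p) []      (suc k) = sym (+-identityʳ _)
  coeff-+P (a ∷ p) (b ∷ q) zero    = refl
  coeff-+P (a ∷ p) (b ∷ q) (suc k) = coeff-+P p q k

  coeff-scaleP : ∀ a p k → coeff (scaleP a p) k ≈ a * coeff p k
  coeff-scaleP a []      k       = sym (zeroʳ a)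
  coeff-scaleP a (x ∷ p) zero    = refl
  coeff-scaleP a (x ∷ p) (suc k) = coeff-scaleP a p k

  coeff-negP : ∀ p k → coeff (negP p) k ≈ - coeff p k
  coeff-negP []      k       = sym -0#≈0#
  coeff-negP (x ∷ p) zero    = refl
  coeff-negP (x ∷ p) (suc k) = coeff-negP p k

  coeff-derivP≈0 : ∀ p k → coeff p (suc k) ≈ 0# → coeff (derivP p) k ≈ 0#
  coeff-derivP≈0 []      k = λ _ → refl
  coeff-derivP≈0 (_ ∷ p) k = coeff-derivAux≈0 1 p k
    where
    coeff-derivAux≈0 : ∀ n p k → coeff p k ≈ 0# → coeff (derivAux n p) k ≈ 0#
    coeff-derivAux≈0 n []      k       _  = refl
    coeff-derivAux≈0 n (x ∷ p) zero    x≈0 = *-≈0ʳ (fromℕ n) x≈0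
    coeff-derivAux≈0 n (x ∷ p) (suc k) h  = coeff-derivAux≈0 (suc n) p k h

  coeff-*P≈0 : ∀ p q (P Q : ℕ → Set) → (∀ i → P i → coeff p i ≈ 0#) → (∀ l → Q l → coeff q l ≈ 0#) →
               ∀ j → (∀ i l → i ℕ.+ l ≡ j → P i ⊎ Q l) → coeff (p *P q) j ≈ 0#
  coeff-*P≈0 []      q P Q p≈0 q≈0 j split = refl
  coeff-*P≈0 (a ∷ p) q P Q p≈0 q≈0 j split =
    trans (coeff-+P (scaleP a q) (0# ∷ (p *P q)) j) (+-≈0 head (shifted j split))
    where
    head : coeff (scaleP a q) j ≈ 0#
    head with split 0 j ≡.refl
    ... | inj₁ P0 = trans (coeff-scaleP a q j) (*-≈0ˡ _ (p≈0 0 P0))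
    ... | inj₂ Qj = trans (coeff-scaleP a q j) (*-≈0ʳ a (q≈0 j Qj))
    shifted : ∀ j → (∀ i l → i ℕ.+ l ≡ j → P i ⊎ Q l) → coeff (0# ∷ (p *P q)) j ≈ 0#
    shifted zero    _     = refl
    shifted (suc j) split = coeff-*P≈0 p q (λ i → P (suc i)) Q (λ i → p≈0 (suc i)) q≈0 j
                              (λ i l i+l≡j → split (suc i) l (≡.cong suc i+l≡j))

  coeff-*P-single : ∀ p q (P Q : ℕ → Set) → (∀ i → P i → coeff p i ≈ 0#) → (∀ l → Q l → coeff q l ≈ 0#) →
                    ∀ i₀ l₀ → (∀ i l → i ℕ.+ l ≡ i₀ ℕ.+ l₀ → i ≢ i₀ → P i ⊎ Q l) →
                    coeff (p *P q) (i₀ ℕ.+ l₀) ≈ coeff p i₀ * coeff q l₀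
  coeff-*P-single []      q P Q p≈0 q≈0 i₀ l₀ split = sym (zeroˡ _)
  coeff-*P-single (a ∷ p) q P Q p≈0 q≈0 zero l₀ split = begin
    coeff (scaleP a q +P (0# ∷ (p *P q))) l₀     ≈⟨ coeff-+P (scaleP a q) (0# ∷ (p *P q)) l₀ ⟩
    coeff (scaleP a q) l₀ + coeff (0# ∷ (p *P q)) l₀ ≈⟨ +-cong (coeff-scaleP a q l₀) (shifted l₀ split) ⟩
    a * coeff q l₀ + 0#                          ≈⟨ +-identityʳ _ ⟩
    a * coeff q l₀                               ∎
    where
    open import Relation.Binary.Reasoning.Setoid setoid
    shifted : ∀ j → (∀ i l → i ℕ.+ l ≡ j → i ≢ 0 → P i ⊎ Q l) → coeff (0# ∷ (p *P q)) j ≈ 0#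
    shifted zero    _     = refl
    shifted (suc j) split = coeff-*P≈0 p q (λ i → P (suc i)) Q (λ i → p≈0 (suc i)) q≈0 j
                              (λ i l i+l≡j → split (suc i) l (≡.cong suc i+l≡j) (λ ()))
  coeff-*P-single (a ∷ p) q P Q p≈0 q≈0 (suc i₀) l₀ split = begin
    coeff (scaleP a q +P (0# ∷ (p *P q))) (suc i₀ ℕ.+ l₀)
      ≈⟨ coeff-+P (scaleP a q) (0# ∷ (p *P q)) (suc i₀ ℕ.+ l₀) ⟩
    coeff (scaleP a q) (suc i₀ ℕ.+ l₀) + coeff (p *P q) (i₀ ℕ.+ l₀)
      ≈⟨ +-cong head (coeff-*P-single p q (λ i → P (suc i)) Q (λ i → p≈0 (suc i)) q≈0 i₀ l₀
                        (λ i l i+l≡ i≢i₀ → split (suc i) l (≡.cong suc i+l≡)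
                                                  (λ 1+i≡ → i≢i₀ (ℕP.suc-injective 1+i≡)))) ⟩
    0# + coeff p i₀ * coeff q l₀
      ≈⟨ +-identityˡ _ ⟩
    coeff p i₀ * coeff q l₀ ∎
    where
    open import Relation.Binary.Reasoning.Setoid setoid
    head : coeff (scaleP a q) (suc i₀ ℕ.+ l₀) ≈ 0#
    head with split 0 (suc i₀ ℕ.+ l₀) ≡.refl (λ ())
    ... | inj₁ P0 = trans (coeff-scaleP a q _) (*-≈0ˡ _ (p≈0 0 P0))
    ... | inj₂ Ql = trans (coeff-scaleP a q _) (*-≈0ʳ a (q≈0 _ Ql))

  private
    +-<-splitℕ : ∀ {a b i l} → a ℕ.+ b < i ℕ.+ l → a < i ⊎ b < l
    +-<-splitℕ {a} {b} {i} {l} a+b<i+l with a ℕP.<? i | b ℕP.<? l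
    ... | yes a<i | _       = inj₁ a<i
    ... | no _    | yes b<l = inj₂ b<l
    ... | no a≮i  | no b≮l  = ⊥-elim (ℕP.<⇒≱ a+b<i+l (ℕP.+-mono-≤ (ℕP.≮⇒≥ a≮i) (ℕP.≮⇒≥ b≮l)))

    +-≡-split : ∀ {a b i l} → i ℕ.+ l ≡ a ℕ.+ b → i ≢ a → a < i ⊎ b < l
    +-≡-split {a} {b} {i} {l} i+l≡a+b i≢a with ℕP.<-cmp i a
    ... | tri< i<a _ _ = inj₂ (ℕP.≰⇒> λ l≤b → ℕP.<-irrefl i+l≡a+b (ℕP.+-mono-<-≤ i<a l≤b))
    ... | tri≈ _ i≡a _ = ⊥-elim (i≢a i≡a)
    ... | tri> _ _ a<i = inj₁ a<i

  DegEq-1 : DegEq (constP 1#) 0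
  DegEq-1 = 1≉0 , λ { (suc k) _ → refl }

  DegEq-*P : ∀ p q {dp dq} → DegEq p dp → DegEq q dq → DegEq (p *P q) (dp ℕ.+ dq)
  DegEq-*P p q {dp} {dq} (p≉0 , p≈0) (q≉0 , q≈0) =
    (λ pq≈0 → *-nonzero p≉0 q≉0 (trans (sym leading) pq≈0)) ,
    (λ j dp+dq<j → coeff-*P≈0 p q (dp <_) (dq <_) p≈0 q≈0 j
                     (λ i l i+l≡j → +-<-splitℕ (≡.subst (dp ℕ.+ dq <_) (≡.sym i+l≡j) dp+dq<j)))
    where
    leading : coeff (p *P q) (dp ℕ.+ dq) ≈ coeff p dp * coeff q dq
    leading = coeff-*P-single p q (dp <_) (dq <_) p≈0 q≈0 dp dq (λ i l → +-≡-split)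

  DegEq-+P-dominantˡ : ∀ p q {d} → DegEq p d → DegLt q d → DegEq (p +P q) d
  DegEq-+P-dominantˡ p q {d} (p≉0 , p≈0) q≈0 =
    (λ p+q≈0 → p≉0 (trans (sym leading) p+q≈0)) ,
    (λ j d<j → trans (coeff-+P p q j) (+-≈0 (p≈0 j d<j) (q≈0 j (ℕP.<⇒≤ d<j))))
    where
    leading : coeff (p +P q) d ≈ coeff p d
    leading = trans (coeff-+P p q d) (trans (+-congˡ (q≈0 d ℕP.≤-refl)) (+-identityʳ _))

  DegEq-+P-dominantʳ : ∀ p q {d} → DegLt p d → DegEq q d → DegEq (p +P q) d
  DegEq-+P-dominantʳ p q {d} p≈0 (q≉0 , q≈0) =
    (λ p+q≈0 → q≉0 (trans (sym leading) p+q≈0)) ,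
    (λ j d<j → trans (coeff-+P p q j) (+-≈0 (p≈0 j (ℕP.<⇒≤ d<j)) (q≈0 j d<j)))
    where
    leading : coeff (p +P q) d ≈ coeff q d
    leading = trans (coeff-+P p q d) (trans (+-congʳ (p≈0 d ℕP.≤-refl)) (+-identityˡ _))

  DegEq-negP : ∀ p {d} → DegEq p d → DegEq (negP p) d
  DegEq-negP p {d} (p≉0 , p≈0) =
    (λ -p≈0 → p≉0 (trans (sym (-‿involutive _)) (-‿≈0 (trans (sym (coeff-negP p d)) -p≈0)))) ,
    (λ j d<j → trans (coeff-negP p j) (-‿≈0 (p≈0 j d<j)))

  DegLt-negP : ∀ p {d} → DegLt p d → DegLt (negP p) d
  DegLt-negP p p≈0 j d≤j = trans (coeff-negP p j) (-‿≈0 (p≈0 j d≤j))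

  zero-or-degree : ∀ p → ¬ ¬ (IsZeroP p ⊎ Σ ℕ (DegEq p))
  zero-or-degree []      = pure (inj₁ λ _ → refl)
  zero-or-degree (a ∷ p) = do
    inj₁ p≈0 ← zero-or-degree p
      where inj₂ (d , p≉0 , p≈0) → pure (inj₂ (suc d , p≉0 , λ { (suc k) (s≤s d<k) → p≈0 k d<k }))
    yes a≈0 ← ¬¬-excluded-middle
      where no a≉0 → pure (inj₂ (0 , a≉0 , λ { (suc k) _ → p≈0 k }))
    pure (inj₁ λ { zero → a≈0 ; (suc k) → p≈0 k })

  FracDegrees : Frac → Set ℓ
  FracDegrees f = Σ ℕ (DegEq (den f)) × (IsZeroP (num f) ⊎ Σ ℕ (DegEq (num f)))

  fracDegrees : ∀ f → WFFrac f → ¬ ¬ FracDegrees f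
  fracDegrees f f-wf = do
    inj₂ den-deg ← zero-or-degree (den f)
      where inj₁ den≈0 → ⊥-elim (f-wf den≈0)
    num-zero-or-deg ← zero-or-degree (num f)
    pure (den-deg , num-zero-or-deg)

  opDegrees : ∀ A → WFOp A → ¬ ¬ (∀ k → FracDegrees (coeffOp A k))
  opDegrees []      _    = pure λ _ → (0 , DegEq-1) , inj₁ (λ _ → refl)
  opDegrees (a ∷ A) A-wf = do
    a-deg ← fracDegrees a (A-wf 0)
    A-deg ← opDegrees A (λ k → A-wf (suc k))
    pure λ { zero → a-deg ; (suc k) → A-deg k }

  module FractionWeight (m : ℕ) (ε : ℤ) where
    open Weight m ε

    record WeightAtMost (f : Frac) (k : ℕ) (W : ℤ) : Set ℓ where
      constructor atMost
      field
        denDeg : ℕ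
        den-deg : DegEq (den f) denDeg
        num-vanish : ∀ j → W ℤ.< weight j denDeg k → coeff (num f) j ≈ 0#

    record HasWeight (f : Frac) (k : ℕ) (W : ℤ) : Set ℓ where
      constructor hasWeight
      field
        denDeg numDeg : ℕ
        den-deg : DegEq (den f) denDeg
        num-deg : DegEq (num f) numDeg
        weight≡ : weight numDeg denDeg k ≡ W

    atMost-0F : ∀ k W → WeightAtMost 0F k W
    atMost-0F k W = atMost 0 DegEq-1 λ _ _ → refl

    atMost-≈0 : ∀ {f d} k W → DegEq (den f) d → IsZeroF f → WeightAtMost f k W
    atMost-≈0 k W den-d f≈0 = atMost _ den-d λ j _ → f≈0 j

    atMost-mono : ∀ {f k W W′} → W ℤ.≤ W′ → WeightAtMost f k W → WeightAtMost f k W′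
    atMost-mono W≤W′ (atMost d den-d vanish) = atMost d den-d λ j W′<wt → vanish j (ℤP.≤-<-trans W≤W′ W′<wt)

    has⇒atMost : ∀ {f k W} → HasWeight f k W → WeightAtMost f k W
    has⇒atMost {f} {k} {W} (hasWeight d a den-d (_ , num≈0) wt≡W) = atMost d den-d vanish
      where
      vanish : ∀ j → W ℤ.< weight j d k → coeff (num f) j ≈ 0#
      vanish j W<wt with a ℕP.<? j
      ... | yes a<j = num≈0 j a<j
      ... | no  a≮j = ⊥-elim (ℤP.<⇒≱ W<wt (≡.subst (weight j d k ℤ.≤_) wt≡W
                                (weight-mono j d a d k (ℕP.+-monoˡ-≤ d (ℕP.≮⇒≥ a≮j)))))

    has⇒nonzero : ∀ {f k W} → HasWeight f k W → ¬ IsZeroF f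
    has⇒nonzero (hasWeight _ a _ (num≉0 , _) _) f≈0 = num≉0 (f≈0 a)

    has-polyF : ∀ {p a k W} → DegEq p a → weight a 0 k ≡ W → HasWeight (polyF p) k W
    has-polyF p-a wt≡W = hasWeight 0 _ DegEq-1 p-a wt≡W

    atMost-polyF : ∀ {p n k W} → DegLt p (suc n) → weight n 0 k ℤ.≤ W → WeightAtMost (polyF p) k W
    atMost-polyF {p} {n} {k} {W} p<1+n wt≤W = atMost 0 DegEq-1 vanish
      where
      vanish : ∀ j → W ℤ.< weight j 0 k → coeff p j ≈ 0#
      vanish j W<wt with n ℕP.<? j
      ... | yes n<j = p<1+n j n<j
      ... | no  n≮j = ⊥-elim (ℤP.<⇒≱ W<wt
                        (ℤP.≤-trans (weight-mono j 0 n 0 k (ℕP.+-monoˡ-≤ 0 (ℕP.≮⇒≥ n≮j))) wt≤W))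

    atMost-suc-order : ∀ {f k W} → WeightAtMost f k W → WeightAtMost f (suc k) (W ℤ.+ ε)
    atMost-suc-order {k = k} (atMost d den-d vanish) =
      atMost d den-d λ j lt → vanish j (+-cancelʳ-< ε (≡.subst (_ ℤ.<_) (weight-suc-order j d k) lt))

    atMost-pred-order : ∀ {f k W} → WeightAtMost f (suc k) W → WeightAtMost f k (W ℤ.- ε)
    atMost-pred-order {k = k} (atMost d den-d vanish) =
      atMost d den-d λ j lt → vanish j (≡.subst (_ ℤ.<_) (≡.sym (weight-suc-order j d k)) (i-k<j⇒i<j+k ε lt))

    has-suc-order : ∀ {f k W} → HasWeight f k W → HasWeight f (suc k) (W ℤ.+ ε)
    has-suc-order {k = k} (hasWeight d a den-d num-a wt≡W) =
      hasWeight d a den-d num-a (≡.trans (weight-suc-order a d k) (≡.cong (ℤ._+ ε) wt≡W))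

    has-pred-order : ∀ {f k W} → HasWeight f (suc k) W → HasWeight f k (W ℤ.- ε)
    has-pred-order {k = k} {W} (hasWeight d a den-d num-a wt≡W) =
      hasWeight d a den-d num-a (begin
        weight a d k                 ≡⟨ w+ε-ε≡w (weight a d k) ε ⟨
        weight a d k ℤ.+ ε ℤ.- ε     ≡⟨ ≡.cong (ℤ._- ε) (≡.trans (≡.sym (weight-suc-order a d k)) wt≡W) ⟩
        W ℤ.- ε                      ∎)
      where
      open ≡-Reasoning
      w+ε-ε≡w : ∀ w e → w ℤ.+ e ℤ.- e ≡ w
      w+ε-ε≡w = solve-∀

    atMost-*F : ∀ {f g k U W} → WeightAtMost f 0 U → WeightAtMost g k W → WeightAtMost (f *F g) k (U ℤ.+ W)
    atMost-*F {f} {g} {k} {U} {W} (atMost d₁ den₁ vanish₁) (atMost d₂ den₂ vanish₂) =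
      atMost (d₁ ℕ.+ d₂) (DegEq-*P (den f) (den g) den₁ den₂)
      λ j lt → coeff-*P≈0 (num f) (num g) (λ i → U ℤ.< weight i d₁ 0) (λ l → W ℤ.< weight l d₂ k)
                 vanish₁ vanish₂ j (λ { i l ≡.refl → +-<-split (≡.subst (_ ℤ.<_) (weight-+ i l d₁ d₂ k) lt) })

    has-*F : ∀ {f g k U W} → HasWeight f 0 U → HasWeight g k W → HasWeight (f *F g) k (U ℤ.+ W)
    has-*F {f} {g} {k} (hasWeight d₁ a₁ den₁ num₁ wt₁) (hasWeight d₂ a₂ den₂ num₂ wt₂) =
      hasWeight (d₁ ℕ.+ d₂) (a₁ ℕ.+ a₂) (DegEq-*P (den f) (den g) den₁ den₂) (DegEq-*P (num f) (num g) num₁ num₂)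
        (≡.trans (weight-+ a₁ a₂ d₁ d₂ k) (≡.cong₂ ℤ._+_ wt₁ wt₂))

    heavy-factor : ∀ {W i l j} d₁ d₂ k → W ℤ.< weight j (d₁ ℕ.+ d₂) k → i ℕ.+ l ≡ j →
                   W ℤ.< weight i d₁ k ⊎ d₂ < l
    heavy-factor {l = l} d₁ d₂ k W<wt i+l≡j with d₂ ℕP.<? l
    ... | yes d₂<l = inj₂ d₂<l
    ... | no  d₂≮l = inj₁ (ℤP.<-≤-trans W<wt (weight-≤-dropʳ d₁ d₂ k i+l≡j (ℕP.≮⇒≥ d₂≮l)))

    atMost-+F : ∀ {f g k W} → WeightAtMost f k W → WeightAtMost g k W → WeightAtMost (f +F g) k W
    atMost-+F {f} {g} {k} {W} (atMost d den-d vanish-f) (atMost e den-e vanish-g) =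
      atMost (d ℕ.+ e) (DegEq-*P (den f) (den g) den-d den-e)
      λ j W<wt → trans (coeff-+P (num f *P den g) (num g *P den f) j)
        (+-≈0 (coeff-*P≈0 (num f) (den g) _ _ vanish-f (proj₂ den-e) j
                 (λ i l → heavy-factor d e k W<wt))
              (coeff-*P≈0 (num g) (den f) _ _ vanish-g (proj₂ den-d) j
                 (λ i l → heavy-factor e d k (≡.subst (λ x → W ℤ.< weight j x k) (ℕP.+-comm d e) W<wt))))

    -- Cross-multiplying a/b with a lighter c/e, the term c·b stays below the degree of a·e.
    lighter-cross-term : ∀ g b {db dg a k W′} → DegEq b db → (∀ i → W′ ℤ.< weight i dg k → coeff g i ≈ 0#) →
                        W′ ℤ.< weight a db k → DegLt (g *P b) (a ℕ.+ dg)
    lighter-cross-term g b {db} {dg} {a} {k} {W′} (_ , b≈0) vanish W′<wt j a+dg≤j =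
      coeff-*P≈0 g b (λ i → W′ ℤ.< weight i dg k) (db <_) vanish b≈0 j split
      where
      split : ∀ i l → i ℕ.+ l ≡ j → W′ ℤ.< weight i dg k ⊎ db < l
      split i l ≡.refl with db ℕP.<? l
      ... | yes db<l = inj₂ db<l
      ... | no  db≮l = inj₁ (ℤP.<-≤-trans W′<wt (weight-mono a db i dg k
                         (ℕP.≤-trans a+dg≤j (ℕP.+-monoʳ-≤ i (ℕP.≮⇒≥ db≮l)))))

    has-+F-dominantˡ : ∀ {f g k W} → HasWeight f k W → WeightAtMost g k (ℤ.pred W) → HasWeight (f +F g) k W
    has-+F-dominantˡ {f} {g} {k} {W} (hasWeight d a den-d num-a wt≡W) (atMost e den-e vanish) =
      hasWeight (d ℕ.+ e) (a ℕ.+ e) (DegEq-*P (den f) (den g) den-d den-e)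
        (DegEq-+P-dominantˡ (num f *P den g) (num g *P den f) (DegEq-*P (num f) (den g) num-a den-e)
          (lighter-cross-term (num g) (den f) den-d vanish (≡.subst (ℤ.pred W ℤ.<_) (≡.sym wt≡W) (pred<self W))))
        (≡.trans (weight-cancel a d e k) wt≡W)

    has-+F-dominantʳ : ∀ {f g k W} → WeightAtMost f k (ℤ.pred W) → HasWeight g k W → HasWeight (f +F g) k W
    has-+F-dominantʳ {f} {g} {k} {W} (atMost d den-d vanish) (hasWeight e a den-e num-a wt≡W) =
      hasWeight (d ℕ.+ e) (a ℕ.+ d) (DegEq-*P (den f) (den g) den-d den-e)
        (DegEq-+P-dominantʳ (num f *P den g) (num g *P den f)
          (lighter-cross-term (num f) (den g) den-e vanish (≡.subst (ℤ.pred W ℤ.<_) (≡.sym wt≡W) (pred<self W)))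
          (DegEq-*P (num g) (den f) num-a den-d))
        (≡.trans (≡.cong (λ x → weight (a ℕ.+ d) x k) (ℕP.+-comm d e)) (≡.trans (weight-cancel a e d k) wt≡W))

    atMost-derivF : ∀ {f k W} → WeightAtMost f k W → WeightAtMost (derivF f) k (W ℤ.- + m)
    atMost-derivF {f} {k} {W} (atMost d den-d vanish) =
      atMost (d ℕ.+ d) (DegEq-*P (den f) (den f) den-d den-d)
      λ j lt → trans (coeff-+P (derivP (num f) *P den f) (negP (num f *P derivP (den f))) j)
        (+-≈0 (coeff-*P≈0 (derivP (num f)) (den f) _ _
                 (λ i W<wt → coeff-derivP≈0 (num f) i (vanish (suc i) W<wt)) (proj₂ den-d) j
                 (λ i l → numerator-derived lt))
              (trans (coeff-negP (num f *P derivP (den f)) j) (-‿≈0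
                 (coeff-*P≈0 (num f) (derivP (den f)) _ _
                    vanish (λ l d≤l → coeff-derivP≈0 (den f) l (proj₂ den-d (suc l) (s≤s d≤l))) j
                    (λ i l → denominator-derived lt)))))
      where
      numerator-derived : ∀ {i l j} → W ℤ.- + m ℤ.< weight j (d ℕ.+ d) k → i ℕ.+ l ≡ j →
                          W ℤ.< weight (suc i) d k ⊎ d < l
      numerator-derived {i} lt i+l≡j with heavy-factor d d k lt i+l≡j
      ... | inj₁ W-m<wt = inj₁ (≡.subst (W ℤ.<_) (≡.sym (weight-suc-num i d k)) (i-k<j⇒i<j+k (+ m) W-m<wt))
      ... | inj₂ d<l    = inj₂ d<l
      denominator-derived : ∀ {i l j} → W ℤ.- + m ℤ.< weight j (d ℕ.+ d) k → i ℕ.+ l ≡ j →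
                            W ℤ.< weight i d k ⊎ d ≤ l
      denominator-derived {i} {l} {j} lt i+l≡j
        with heavy-factor d d k (≡.subst (W ℤ.<_) (≡.sym (weight-suc-num j (d ℕ.+ d) k)) (i-k<j⇒i<j+k (+ m) lt))
                                (≡.trans (ℕP.+-suc i l) (≡.cong suc i+l≡j))
      ... | inj₁ W<wt  = inj₁ W<wt
      ... | inj₂ d<1+l = inj₂ (ℕ.s≤s⁻¹ d<1+l)

    has-≈F-atMost⇒≤ : ∀ {f g k W W′} → HasWeight f k W → f ≈F g → WeightAtMost g k W′ → W ℤ.≤ W′
    has-≈F-atMost⇒≤ {f} {g} {k} {W} {W′} (hasWeight d a den-d num-a wt≡W) f≈g (atMost e den-e vanish) =
      ℤP.≮⇒≥ λ W′<W → proj₁ (DegEq-*P (num f) (den g) num-a den-e)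
        (trans (f≈g (a ℕ.+ e))
               (lighter-cross-term (num g) (den f) den-d vanish (≡.subst (W′ ℤ.<_) (≡.sym wt≡W) W′<W)
                                   (a ℕ.+ e) ℕP.≤-refl))

  -- Past the end of the shorter list, `_+Op_` copies the other list: no sum with 0F is formed.
  coeffOp-+Op : ∀ A B k → coeffOp (A +Op B) k ≡ coeffOp A k +F coeffOp B k
                        ⊎ coeffOp A k ≡ 0F × coeffOp (A +Op B) k ≡ coeffOp B k
                        ⊎ coeffOp B k ≡ 0F × coeffOp (A +Op B) k ≡ coeffOp A k
  coeffOp-+Op []      B       k       = inj₂ (inj₁ (≡.refl , ≡.refl))
  coeffOp-+Op (a ∷ A) []      k       = inj₂ (inj₂ (≡.refl , ≡.refl))
  coeffOp-+Op (a ∷ A) (b ∷ B) zero    = inj₁ ≡.refl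
  coeffOp-+Op (a ∷ A) (b ∷ B) (suc k) = coeffOp-+Op A B k

  coeffOp-scaleOp : ∀ f B k → coeffOp (scaleOp f B) k ≡ f *F coeffOp B k
                            ⊎ coeffOp B k ≡ 0F × coeffOp (scaleOp f B) k ≡ 0F
  coeffOp-scaleOp f []      k       = inj₂ (≡.refl , ≡.refl)
  coeffOp-scaleOp f (b ∷ B) zero    = inj₁ ≡.refl
  coeffOp-scaleOp f (b ∷ B) (suc k) = coeffOp-scaleOp f B k

  coeffOp-map-derivF : ∀ B k → coeffOp (map derivF B) k ≡ derivF (coeffOp B k) ⊎ coeffOp (map derivF B) k ≡ 0F
  coeffOp-map-derivF []      k       = inj₂ ≡.refl
  coeffOp-map-derivF (b ∷ B) zero    = inj₁ ≡.refl
  coeffOp-map-derivF (b ∷ B) (suc k) = coeffOp-map-derivF B k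

  module OperatorWeight (m : ℕ) (ε : ℤ) (-m<ε : ℤ.- + m ℤ.< ε) where
    open Weight m ε
    open FractionWeight m ε

    OpAtMost : Op → ℤ → Set ℓ
    OpAtMost A W = ∀ k → WeightAtMost (coeffOp A k) k W

    PeakAt : Op → ℕ → ℤ → Set ℓ
    PeakAt A α W = HasWeight (coeffOp A α) α W × (∀ k → k ≢ α → WeightAtMost (coeffOp A k) k (ℤ.pred W))

    peak⇒atMost : ∀ A {α W} → PeakAt A α W → OpAtMost A W
    peak⇒atMost A {α} (peak , others) k with k ℕ.≟ α
    ... | yes ≡.refl = has⇒atMost peak
    ... | no  k≢α   = atMost-mono (ℤP.<⇒≤ (pred<self _)) (others k k≢α)

    atMost-+Op : ∀ A B k {W} → WeightAtMost (coeffOp A k) k W → WeightAtMost (coeffOp B k) k W →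
                 WeightAtMost (coeffOp (A +Op B) k) k W
    atMost-+Op A B k {W} hA hB with coeffOp-+Op A B k
    ... | inj₁ sum              = ≡.subst (λ f → WeightAtMost f k W) (≡.sym sum) (atMost-+F hA hB)
    ... | inj₂ (inj₁ (_ , onlyB)) = ≡.subst (λ f → WeightAtMost f k W) (≡.sym onlyB) hB
    ... | inj₂ (inj₂ (_ , onlyA)) = ≡.subst (λ f → WeightAtMost f k W) (≡.sym onlyA) hA

    has-+Opˡ : ∀ A B k {W} → HasWeight (coeffOp A k) k W → WeightAtMost (coeffOp B k) k (ℤ.pred W) →
               HasWeight (coeffOp (A +Op B) k) k W
    has-+Opˡ A B k {W} hA hB with coeffOp-+Op A B k
    ... | inj₁ sum               = ≡.subst (λ f → HasWeight f k W) (≡.sym sum) (has-+F-dominantˡ hA hB)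
    ... | inj₂ (inj₁ (A≡0 , _))  = ⊥-elim (has⇒nonzero hA (≡.subst IsZeroF (≡.sym A≡0) (λ _ → refl)))
    ... | inj₂ (inj₂ (_ , onlyA)) = ≡.subst (λ f → HasWeight f k W) (≡.sym onlyA) hA

    has-+Opʳ : ∀ A B k {W} → WeightAtMost (coeffOp A k) k (ℤ.pred W) → HasWeight (coeffOp B k) k W →
               HasWeight (coeffOp (A +Op B) k) k W
    has-+Opʳ A B k {W} hA hB with coeffOp-+Op A B k
    ... | inj₁ sum               = ≡.subst (λ f → HasWeight f k W) (≡.sym sum) (has-+F-dominantʳ hA hB)
    ... | inj₂ (inj₁ (_ , onlyB)) = ≡.subst (λ f → HasWeight f k W) (≡.sym onlyB) hB
    ... | inj₂ (inj₂ (B≡0 , _))  = ⊥-elim (has⇒nonzero hB (≡.subst IsZeroF (≡.sym B≡0) (λ _ → refl)))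

    atMost-scaleOp : ∀ f B k {U W} → WeightAtMost f 0 U → WeightAtMost (coeffOp B k) k W →
                     WeightAtMost (coeffOp (scaleOp f B) k) k (U ℤ.+ W)
    atMost-scaleOp f B k {U} {W} hf hB with coeffOp-scaleOp f B k
    ... | inj₁ prod     = ≡.subst (λ g → WeightAtMost g k (U ℤ.+ W)) (≡.sym prod) (atMost-*F hf hB)
    ... | inj₂ (_ , ≡0) = ≡.subst (λ g → WeightAtMost g k (U ℤ.+ W)) (≡.sym ≡0) (atMost-0F k _)

    has-scaleOp : ∀ f B k {U W} → HasWeight f 0 U → HasWeight (coeffOp B k) k W →
                  HasWeight (coeffOp (scaleOp f B) k) k (U ℤ.+ W)
    has-scaleOp f B k {U} {W} hf hB with coeffOp-scaleOp f B k
    ... | inj₁ prod      = ≡.subst (λ g → HasWeight g k (U ℤ.+ W)) (≡.sym prod) (has-*F hf hB)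
    ... | inj₂ (B≡0 , _) = ⊥-elim (has⇒nonzero hB (≡.subst IsZeroF (≡.sym B≡0) (λ _ → refl)))

    -- Differentiating costs weight m ≥ 1 - ε, so D·f = f·D + f′ is dominated by f·D.
    derivatives-lighter : ∀ B {W} → OpAtMost B W → OpAtMost (map derivF B) (ℤ.pred (W ℤ.+ ε))
    derivatives-lighter B {W} hB k with coeffOp-map-derivF B k
    ... | inj₁ deriv = ≡.subst (λ f → WeightAtMost f k _) (≡.sym deriv)
                         (atMost-mono (ℤP.i<j⇒i≤pred[j] (ℤP.+-monoʳ-< W -m<ε)) (atMost-derivF (hB k)))
    ... | inj₂ ≡0    = ≡.subst (λ f → WeightAtMost f k _) (≡.sym ≡0) (atMost-0F k _)

    atMost-DOp : ∀ B {W} → OpAtMost B W → OpAtMost (DOp B) (W ℤ.+ ε)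
    atMost-DOp B {W} hB k =
      atMost-+Op (0F ∷ B) (map derivF B) k (shifted k)
        (atMost-mono (ℤP.<⇒≤ (pred<self _)) (derivatives-lighter B hB k))
      where
      shifted : ∀ k → WeightAtMost (coeffOp (0F ∷ B) k) k (W ℤ.+ ε)
      shifted zero    = atMost-0F 0 _
      shifted (suc k) = atMost-suc-order (hB k)

    peak-DOp : ∀ B {p W} → PeakAt B p W → PeakAt (DOp B) (suc p) (W ℤ.+ ε)
    peak-DOp B {p} {W} peakB@(peak , others) =
      has-+Opˡ (0F ∷ B) (map derivF B) (suc p) (has-suc-order peak) (derivatives-lighter B (peak⇒atMost B peakB) (suc p)) ,
      λ k k≢1+p → atMost-+Op (0F ∷ B) (map derivF B) k (shifted k k≢1+p) (derivatives-lighter B (peak⇒atMost B peakB) k)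
      where
      shifted : ∀ k → k ≢ suc p → WeightAtMost (coeffOp (0F ∷ B) k) k (ℤ.pred (W ℤ.+ ε))
      shifted zero    _       = atMost-0F 0 _
      shifted (suc k) 1+k≢1+p = ≡.subst (WeightAtMost (coeffOp B k) (suc k)) (ℤP.pred-+ W ε)
                                  (atMost-suc-order (others k (λ k≡p → 1+k≢1+p (≡.cong suc k≡p))))

    private
      u-e+[w+e]≡u+w : ∀ u w e → u ℤ.- e ℤ.+ (w ℤ.+ e) ≡ u ℤ.+ w
      u-e+[w+e]≡u+w = solve-∀

    atMost-*Op : ∀ A B {U W} → OpAtMost A U → OpAtMost B W → OpAtMost (A *Op B) (U ℤ.+ W)
    atMost-*Op []      B         hA hB k = atMost-0F k _
    atMost-*Op (a ∷ A) B {U} {W} hA hB k =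
      atMost-+Op (scaleOp a B) (A *Op DOp B) k (atMost-scaleOp a B k (hA 0) (hB k))
        (≡.subst (WeightAtMost _ k) (u-e+[w+e]≡u+w U W ε)
          (atMost-*Op A (DOp B) (λ i → atMost-pred-order (hA (suc i))) (atMost-DOp B hB) k))

    peak-*Op : ∀ A B {α β U W} → PeakAt A α U → PeakAt B β W → PeakAt (A *Op B) (α ℕ.+ β) (U ℤ.+ W)
    peak-*Op []      B (peak , _) _ = ⊥-elim (has⇒nonzero peak (λ _ → refl))
    peak-*Op (a ∷ A) B {zero} {β} {U} {W} (peak-a , others) peakB@(peak-b , others-b) =
      has-+Opˡ (scaleOp a B) (A *Op DOp B) β (has-scaleOp a B β peak-a peak-b) (rest β) ,
      λ k k≢β → atMost-+Op (scaleOp a B) (A *Op DOp B) k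
                  (≡.subst (WeightAtMost _ k) (ℤP.+-pred U W)
                    (atMost-scaleOp a B k (has⇒atMost peak-a) (others-b k k≢β)))
                  (rest k)
      where
      pred-u-e+[w+e]≡pred[u+w] : ∀ u w e → (ℤ.-1ℤ ℤ.+ u) ℤ.- e ℤ.+ (w ℤ.+ e) ≡ ℤ.-1ℤ ℤ.+ (u ℤ.+ w)
      pred-u-e+[w+e]≡pred[u+w] = solve-∀
      rest : OpAtMost (A *Op DOp B) (ℤ.pred (U ℤ.+ W))
      rest k = ≡.subst (WeightAtMost _ k) (pred-u-e+[w+e]≡pred[u+w] U W ε)
                 (atMost-*Op A (DOp B) (λ i → atMost-pred-order (others (suc i) λ ()))
                   (atMost-DOp B (peak⇒atMost B peakB)) k)
    peak-*Op (a ∷ A) B {suc α} {β} {U} {W} (peak-a , others) peakB =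
      has-+Opʳ (scaleOp a B) (A *Op DOp B) (suc (α ℕ.+ β)) (scaled _) (proj₁ peak-rest) ,
      λ k k≢ → atMost-+Op (scaleOp a B) (A *Op DOp B) k (scaled k) (proj₂ peak-rest k k≢)
      where
      pred-u-e≡pred[u-e] : ∀ u e → (ℤ.-1ℤ ℤ.+ u) ℤ.- e ≡ ℤ.-1ℤ ℤ.+ (u ℤ.- e)
      pred-u-e≡pred[u-e] = solve-∀
      peakA : PeakAt A α (U ℤ.- ε)
      peakA = has-pred-order peak-a ,
              λ k k≢α → ≡.subst (WeightAtMost _ k) (pred-u-e≡pred[u-e] U ε)
                          (atMost-pred-order (others (suc k) (λ 1+k≡1+α → k≢α (ℕP.suc-injective 1+k≡1+α))))
      peak-rest : PeakAt (A *Op DOp B) (suc (α ℕ.+ β)) (U ℤ.+ W)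
      peak-rest = ≡.subst₂ (PeakAt (A *Op DOp B)) (ℕP.+-suc α β) (u-e+[w+e]≡u+w U W ε)
                    (peak-*Op A (DOp B) peakA (peak-DOp B peakB))
      scaled : OpAtMost (scaleOp a B) (ℤ.pred (U ℤ.+ W))
      scaled k = ≡.subst (WeightAtMost _ k) (ℤP.pred-+ U W)
                   (atMost-scaleOp a B k (others 0 (λ ())) (peak⇒atMost B peakB k))

    ZeroOrPeak : Op → Set ℓ
    ZeroOrPeak A = (∀ W → OpAtMost A W) ⊎ Σ ℕ λ α → Σ ℤ (PeakAt A α)

    bounded : ∀ A → ZeroOrPeak A → Σ ℤ (OpAtMost A)
    bounded A (inj₁ zeroA)           = + 0 , zeroA (+ 0)
    bounded A (inj₂ (_ , W , peakA)) = W , peak⇒atMost A peakA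

    zeroOrPeak-*Op : ∀ A B → ZeroOrPeak A → ZeroOrPeak B → ZeroOrPeak (A *Op B)
    zeroOrPeak-*Op A B (inj₁ zeroA) zeroOrPeakB with bounded B zeroOrPeakB
    ... | W₀ , hB =
      inj₁ λ W → ≡.subst (OpAtMost (A *Op B)) (w-w₀+w₀≡w W W₀) (atMost-*Op A B (zeroA (W ℤ.- W₀)) hB)
      where
      w-w₀+w₀≡w : ∀ w w₀ → w ℤ.- w₀ ℤ.+ w₀ ≡ w
      w-w₀+w₀≡w = solve-∀
    zeroOrPeak-*Op A B (inj₂ (_ , U , peakA)) (inj₁ zeroB) =
      inj₁ λ W → ≡.subst (OpAtMost (A *Op B)) (u+[w-u]≡w U W) (atMost-*Op A B (peak⇒atMost A peakA) (zeroB (W ℤ.- U)))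
      where
      u+[w-u]≡w : ∀ u w → u ℤ.+ (w ℤ.- u) ≡ w
      u+[w-u]≡w = solve-∀
    zeroOrPeak-*Op A B (inj₂ (α , U , peakA)) (inj₂ (β , W , peakB)) =
      inj₂ (α ℕ.+ β , U ℤ.+ W , peak-*Op A B peakA peakB)

  module Irreducibility (m : ℕ) (ε : ℤ) (-m<ε : ℤ.- + m ℤ.< ε) (∣ε∣≡1 : ℤ.∣ ε ∣ ≡ 1) where
    open Weight m ε
    open FractionWeight m ε
    open OperatorWeight m ε -m<ε

    distinct-orders-distinct-weights : ∀ {f g i j W} → HasWeight f i W → HasWeight g j W → i < j → j < m → ⊥
    distinct-orders-distinct-weights {i = i} (hasWeight d a _ _ wt≡W) (hasWeight d′ a′ _ _ wt′≡W) i<j j<m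
      with ℕP.m≤n⇒∃[o]m+o≡n i<j
    ... | t , ≡.refl = weight-separates-orders ∣ε∣≡1 a d a′ d′ i t (ℕP.≤-<-trans (s≤s (ℕP.m≤n+m t i)) j<m)
                         (≡.trans wt≡W (≡.trans (≡.sym wt′≡W) (≡.cong (weight a′ d′) (≡.sym (ℕP.+-suc i t)))))

    zero-or-weight : ∀ {f} k → FracDegrees f → (∀ W → WeightAtMost f k W) ⊎ Σ ℤ (HasWeight f k)
    zero-or-weight k ((d , den-d) , inj₁ num≈0)       = inj₁ λ W → atMost-≈0 k W den-d num≈0
    zero-or-weight k ((d , den-d) , inj₂ (a , num-a)) = inj₂ (weight a d k , hasWeight d a den-d num-a ≡.refl)

    PeakBelow : Op → ℕ → Set ℓ
    PeakBelow A n = (∀ k → k < n → ∀ W → WeightAtMost (coeffOp A k) k W)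
                  ⊎ Σ ℕ λ α → Σ ℤ λ U → α < n × HasWeight (coeffOp A α) α U
                                           × (∀ k → k < n → k ≢ α → WeightAtMost (coeffOp A k) k (ℤ.pred U))

    private
      below-suc : ∀ {n} (P : ℕ → Set ℓ) → (∀ k → k < n → P k) → P n → ∀ k → k < suc n → P k
      below-suc P below at-n k k<1+n with ℕP.m<1+n⇒m<n∨m≡n k<1+n
      ... | inj₁ k<n    = below k k<n
      ... | inj₂ ≡.refl = at-n

    peakBelow : ∀ A → (∀ k → FracDegrees (coeffOp A k)) → ∀ n → n ≤ m → PeakBelow A n
    peakBelow A degs zero    _     = inj₁ λ k ()
    peakBelow A degs (suc n) 1+n≤m = extend (peakBelow A degs n (ℕP.<⇒≤ 1+n≤m)) (zero-or-weight n (degs n))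
      where
      keep : ∀ {α U} → α < n → HasWeight (coeffOp A α) α U →
             (∀ k → k < n → k ≢ α → WeightAtMost (coeffOp A k) k (ℤ.pred U)) →
             WeightAtMost (coeffOp A n) n (ℤ.pred U) → PeakBelow A (suc n)
      keep {α} {U} α<n peak others Aₙ≤U =
        inj₂ (α , U , ℕP.m<n⇒m<1+n α<n , peak , below-suc (λ k → k ≢ α → _) others (λ _ → Aₙ≤U))
      replace : ∀ {W} → HasWeight (coeffOp A n) n W → (∀ k → k < n → WeightAtMost (coeffOp A k) k (ℤ.pred W)) →
                PeakBelow A (suc n)
      replace {W} peak earlier =
        inj₂ (n , W , ℕP.n<1+n n , peak ,
              below-suc (λ k → k ≢ n → _) (λ k k<n _ → earlier k k<n) (λ n≢n → ⊥-elim (n≢n ≡.refl)))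
      extend : PeakBelow A n → (∀ W → WeightAtMost (coeffOp A n) n W) ⊎ Σ ℤ (HasWeight (coeffOp A n) n) →
               PeakBelow A (suc n)
      extend (inj₁ zeros) (inj₁ zeroₙ) = inj₁ λ k k<1+n W → below-suc (λ k → WeightAtMost (coeffOp A k) k W)
                                                              (λ k k<n → zeros k k<n W) (zeroₙ W) k k<1+n
      extend (inj₂ (α , U , α<n , peak , others)) (inj₁ zeroₙ) = keep α<n peak others (zeroₙ _)
      extend (inj₁ zeros) (inj₂ (W , peakₙ)) = replace peakₙ (λ k k<n → zeros k k<n _)
      extend (inj₂ (α , U , α<n , peak , others)) (inj₂ (W , peakₙ)) with ℤP.<-cmp W U
      ... | tri< W<U _ _ = keep α<n peak others (atMost-mono (ℤP.i<j⇒i≤pred[j] W<U) (has⇒atMost peakₙ))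
      ... | tri≈ _ W≡U _ = ⊥-elim (distinct-orders-distinct-weights peak (≡.subst (HasWeight (coeffOp A n) n) W≡U peakₙ)
                                     α<n 1+n≤m)
      ... | tri> _ _ U<W = replace peakₙ earlier
        where
        earlier : ∀ k → k < n → WeightAtMost (coeffOp A k) k (ℤ.pred W)
        earlier k k<n with k ℕ.≟ α
        ... | yes ≡.refl = atMost-mono (ℤP.i<j⇒i≤pred[j] U<W) (has⇒atMost peak)
        ... | no  k≢α    = atMost-mono (ℤP.≤-trans (ℤP.<⇒≤ (pred<self U)) (ℤP.i<j⇒i≤pred[j] U<W))
                                       (others k k<n k≢α)

    zero-or-peak : ∀ A → (∀ k → FracDegrees (coeffOp A k)) → OrdLt A m → ZeroOrPeak A
    zero-or-peak A degs A<m = conclude (peakBelow A degs m ℕP.≤-refl)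
      where
      beyond-m : ∀ {k W} → (k < m → WeightAtMost (coeffOp A k) k W) → WeightAtMost (coeffOp A k) k W
      beyond-m {k} {W} below with k ℕP.<? m
      ... | yes k<m = below k<m
      ... | no  k≮m = atMost-≈0 k W (proj₂ (proj₁ (degs k))) (A<m k (ℕP.≮⇒≥ k≮m))
      conclude : PeakBelow A m → ZeroOrPeak A
      conclude (inj₁ zeros) = inj₁ λ W k → beyond-m (λ k<m → zeros k k<m W)
      conclude (inj₂ (α , U , _ , peak , others)) =
        inj₂ (α , U , peak , λ k k≢α → beyond-m (λ k<m → others k k<m k≢α))

    no-factorisation : ∀ L M → m ≢ 0 → HasWeight (coeffOp L 0) 0 M → HasWeight (coeffOp L m) m M → OpAtMost L M →
                       ∀ A B → WFOp A → WFOp B → OrdLt A m → OrdLt B m → (A *Op B) ≈Op L → ⊥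
    no-factorisation L M m≢0 L₀ Lₘ L≤M A B A-wf B-wf A<m B<m AB≈L =
      opDegrees A A-wf λ A-degs → opDegrees B B-wf λ B-degs →
      impossible (zeroOrPeak-*Op A B (zero-or-peak A A-degs A<m) (zero-or-peak B B-degs B<m))
      where
      L≈AB : ∀ k → coeffOp L k ≈F coeffOp (A *Op B) k
      L≈AB k j = sym (AB≈L k j)
      end-off : ∀ γ → Σ ℕ λ k → k ≢ γ × HasWeight (coeffOp L k) k M
      end-off γ with γ ℕ.≟ 0
      ... | yes γ≡0 = m , (λ m≡γ → m≢0 (≡.trans m≡γ γ≡0)) , Lₘ
      ... | no  γ≢0 = 0 , (λ 0≡γ → γ≢0 (≡.sym 0≡γ)) , L₀
      impossible : ZeroOrPeak (A *Op B) → ⊥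
      impossible (inj₁ AB≈0) = ℤP.<⇒≱ (pred<self M) (has-≈F-atMost⇒≤ L₀ (L≈AB 0) (AB≈0 (ℤ.pred M) 0))
      impossible (inj₂ (γ , V , peak , others)) with end-off γ
      ... | k , k≢γ , Lₖ = ℤP.<⇒≱ (ℤP.≤-<-trans M≤pred[V] (pred<self V)) V≤M
        where
        V≤M : V ℤ.≤ M
        V≤M = has-≈F-atMost⇒≤ peak (AB≈L γ) (L≤M γ)
        M≤pred[V] : M ℤ.≤ ℤ.pred V
        M≤pred[V] = has-≈F-atMost⇒≤ Lₖ (L≈AB k) (others k k≢γ)

    irreducible-by-weights : ∀ L M → m ≢ 0 → OrdLt L (suc m) →
                             HasWeight (coeffOp L 0) 0 M → HasWeight (coeffOp L m) m M → OpAtMost L M → Irreducible L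
    irreducible-by-weights L M m≢0 L<1+m L₀ Lₘ L≤M = (λ L≈0 → has⇒nonzero Lₘ (L≈0 m)) , no-factor
      where
      ord≡m : ∀ {d} → OrdEq L d → d ≡ m
      ord≡m {d} (L_d≉0 , L>d≈0) with ℕP.<-cmp d m
      ... | tri< d<m _ _ = ⊥-elim (has⇒nonzero Lₘ (L>d≈0 m d<m))
      ... | tri≈ _ d≡m _ = d≡m
      ... | tri> _ _ m<d = ⊥-elim (L_d≉0 (L<1+m d m<d))
      no-factor : ∀ d → OrdEq L d → ∀ A B → WFOp A → WFOp B → OrdLt A d → OrdLt B d → (A *Op B) ≈Op L → ⊥
      no-factor d ordL with ord≡m ordL
      ... | ≡.refl = no-factorisation L M m≢0 L₀ Lₘ L≤M

  coeffOp-tabulate-++-below : ∀ {n} (h : Fin n → Frac) x {k} (k<n : k < n) →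
                              coeffOp (tabulate h ++ [ x ]) k ≡ h (fromℕ< k<n)
  coeffOp-tabulate-++-below {suc n} h x {zero}  _         = ≡.refl
  coeffOp-tabulate-++-below {suc n} h x {suc k} (s≤s k<n) = coeffOp-tabulate-++-below (λ i → h (Fin.suc i)) x k<n

  coeffOp-tabulate-++-top : ∀ {n} (h : Fin n → Frac) x → coeffOp (tabulate h ++ [ x ]) n ≡ x
  coeffOp-tabulate-++-top {zero}  h x = ≡.refl
  coeffOp-tabulate-++-top {suc n} h x = coeffOp-tabulate-++-top (λ i → h (Fin.suc i)) x

  coeffOp-tabulate-++-above : ∀ {n} (h : Fin n → Frac) x {k} → n < k → coeffOp (tabulate h ++ [ x ]) k ≡ 0F
  coeffOp-tabulate-++-above {zero}  h x {suc k} _         = ≡.refl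
  coeffOp-tabulate-++-above {suc n} h x {suc k} (s≤s n<k) = coeffOp-tabulate-++-above (λ i → h (Fin.suc i)) x n<k

  module Equation (m : ℕ) (T : Poly) (Q : Fin m → Poly) where

    -- E carries −Q_{m−k} at Dᵏ (k < m), and Q_{m−k} is `Q (index k<m)` since Q is indexed from 0.
    index : ∀ {k} → k < m → Fin m
    index k<m = opposite (fromℕ< k<m)

    suc-index : ∀ {k} (k<m : k < m) → suc (toℕ (index k<m)) ≡ m ∸ k
    suc-index {k} k<m = begin
      suc (toℕ (opposite (fromℕ< k<m)))  ≡⟨ ≡.cong suc (FinP.opposite-prop (fromℕ< k<m)) ⟩
      suc (m ∸ suc (toℕ (fromℕ< k<m)))   ≡⟨ ≡.cong (λ i → suc (m ∸ suc i)) (FinP.toℕ-fromℕ< k<m) ⟩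
      suc (m ∸ suc k)                    ≡⟨ ℕP.+-∸-assoc 1 k<m ⟨
      m ∸ k                              ∎
      where open ≡-Reasoning

    lower : Fin m → Frac
    lower i = polyF (negP (Q (opposite i)))

    opE-tabulate : opE m T Q ≡ tabulate lower ++ [ polyF T ]
    opE-tabulate = ≡.cong (_++ [ polyF T ]) (List.map-tabulate id lower)

    coeffOp-opE-below : ∀ {k} (k<m : k < m) → coeffOp (opE m T Q) k ≡ polyF (negP (Q (index k<m)))
    coeffOp-opE-below k<m = ≡.trans (≡.cong (λ A → coeffOp A _) opE-tabulate) (coeffOp-tabulate-++-below lower (polyF T) k<m)

    coeffOp-opE-top : coeffOp (opE m T Q) m ≡ polyF T
    coeffOp-opE-top = ≡.trans (≡.cong (λ A → coeffOp A m) opE-tabulate) (coeffOp-tabulate-++-top lower (polyF T))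

    coeffOp-opE-above : ∀ {k} → m < k → coeffOp (opE m T Q) k ≡ 0F
    coeffOp-opE-above m<k = ≡.trans (≡.cong (λ A → coeffOp A _) opE-tabulate) (coeffOp-tabulate-++-above lower (polyF T) m<k)

    opE<1+m : OrdLt (opE m T Q) (suc m)
    opE<1+m k m<k = ≡.subst IsZeroF (≡.sym (coeffOp-opE-above m<k)) (λ _ → refl)

    suc-index-suc : ∀ {k} (1+k<m : suc k < m) → suc (toℕ (index 1+k<m)) < m
    suc-index-suc 1+k<m =
      ≡.subst (_< m) (≡.sym (suc-index 1+k<m)) (ℕP.∸-monoʳ-< (s≤s z≤n) (ℕP.<⇒≤ 1+k<m))

    module _ (ε : ℤ) (-m<ε : ℤ.- + m ℤ.< ε) (∣ε∣≡1 : ℤ.∣ ε ∣ ≡ 1) where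
      open FractionWeight m ε
      open Irreducibility m ε -m<ε ∣ε∣≡1

      opE-irreducible-by-weights : ∀ M (0<m : 0 < m) → HasWeight (polyF (negP (Q (index 0<m)))) 0 M →
        HasWeight (polyF T) m M → (∀ {k} (k<m : k < m) → WeightAtMost (polyF (negP (Q (index k<m)))) k M) →
        Irreducible (opE m T Q)
      opE-irreducible-by-weights M 0<m E₀ Eₘ lower≤M =
        irreducible-by-weights (opE m T Q) M (ℕP.>⇒≢ 0<m) opE<1+m
          (≡.subst (λ f → HasWeight f 0 M) (≡.sym (coeffOp-opE-below 0<m)) E₀)
          (≡.subst (λ f → HasWeight f m M) (≡.sym coeffOp-opE-top) Eₘ)
          opE≤M
        where
        opE≤M : ∀ k → WeightAtMost (coeffOp (opE m T Q) k) k M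
        opE≤M k with ℕP.<-cmp k m
        ... | tri< k<m _ _    = ≡.subst (λ f → WeightAtMost f k M) (≡.sym (coeffOp-opE-below k<m)) (lower≤M k<m)
        ... | tri≈ _ ≡.refl _ = ≡.subst (λ f → WeightAtMost f k M) (≡.sym coeffOp-opE-top) (has⇒atMost Eₘ)
        ... | tri> _ _ m<k    = ≡.subst (λ f → WeightAtMost f k M) (≡.sym (coeffOp-opE-above m<k)) (atMost-0F k M)

    irreducible-degQₘ≡1+degT : 1 ≤ m → ∀ S → DegEq T S → (∀ j → suc (toℕ j) ≡ m → DegEq (Q j) (suc S)) →
                               (∀ j → suc (toℕ j) < m → DegLt (Q j) (suc S)) → Irreducible (opE m T Q)
    irreducible-degQₘ≡1+degT 0<m S T-S Qₘ-1+S Q<1+S =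
      opE-irreducible-by-weights (+ 1) (-[m]<1 m) ≡.refl M 0<m (E₀ 0<m) Eₘ lower≤M
      where
      open Weight m (+ 1)
      open FractionWeight m (+ 1)
      M = weight (suc S) 0 0
      weight[S,0,m]≡M : weight S 0 m ≡ M
      weight[S,0,m]≡M = lemma (+ m) (+ S)
        where
        lemma : ∀ m S → m ℤ.* (S ℤ.- + 0) ℤ.+ + 1 ℤ.* m ≡ m ℤ.* ((+ 1 ℤ.+ S) ℤ.- + 0) ℤ.+ + 1 ℤ.* + 0
        lemma = solve-∀
      E₀ : (0<m : 0 < m) → HasWeight (polyF (negP (Q (index 0<m)))) 0 M
      E₀ 0<m = has-polyF (DegEq-negP (Q (index 0<m)) (Qₘ-1+S _ (suc-index 0<m))) ≡.refl
      Eₘ : HasWeight (polyF T) m M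
      Eₘ = has-polyF T-S weight[S,0,m]≡M
      lower≤M : ∀ {k} (k<m : k < m) → WeightAtMost (polyF (negP (Q (index k<m)))) k M
      lower≤M {zero}  0<m   = has⇒atMost (E₀ 0<m)
      lower≤M {suc k} 1+k<m = atMost-polyF (DegLt-negP (Q (index 1+k<m)) (Q<1+S _ (suc-index-suc 1+k<m)))
        (ℤP.≤-trans (weight-mono-order S 0 (suc k) m
                      (≡.subst₂ ℤ._≤_ (≡.sym (ℤP.*-identityˡ _)) (≡.sym (ℤP.*-identityˡ _)) (ℤ.+≤+ (ℕP.<⇒≤ 1+k<m))))
                    (ℤP.≤-reflexive weight[S,0,m]≡M))

    irreducible-degT≡1+degQₘ : 2 ≤ m → ∀ r → (∀ j → suc (toℕ j) ≡ m → DegEq (Q j) r) → DegEq T (suc r) →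
                               (∀ j → DegLt (Q j) (suc r)) → Irreducible (opE m T Q)
    irreducible-degT≡1+degQₘ 2≤m r Qₘ-r T-1+r Q<1+r =
      opE-irreducible-by-weights ℤ.-1ℤ (-[m]<-1 2≤m) ≡.refl M 0<m
        (has-polyF (DegEq-negP (Q (index 0<m)) (Qₘ-r _ (suc-index 0<m))) ≡.refl)
        (has-polyF T-1+r weight[1+r,0,m]≡M)
        lower≤M
      where
      open Weight m ℤ.-1ℤ
      open FractionWeight m ℤ.-1ℤ
      0<m : 0 < m
      0<m = ℕP.<-trans (s≤s z≤n) 2≤m
      M = weight r 0 0
      weight[1+r,0,m]≡M : weight (suc r) 0 m ≡ M
      weight[1+r,0,m]≡M = lemma (+ m) (+ r)
        where
        lemma : ∀ m r → m ℤ.* ((+ 1 ℤ.+ r) ℤ.- + 0) ℤ.+ ℤ.-1ℤ ℤ.* m ≡ m ℤ.* (r ℤ.- + 0) ℤ.+ ℤ.-1ℤ ℤ.* + 0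
        lemma = solve-∀
      lower≤M : ∀ {k} (k<m : k < m) → WeightAtMost (polyF (negP (Q (index k<m)))) k M
      lower≤M {k} k<m = atMost-polyF (DegLt-negP (Q (index k<m)) (Q<1+r _))
        (weight-mono-order r 0 k 0
          (≡.subst₂ ℤ._≤_ (≡.sym (ℤP.-1*i≡-i (+ k))) (≡.sym (ℤP.-1*i≡-i (+ 0))) (ℤP.neg-mono-≤ (ℤ.+≤+ z≤n))))

corollary4p2 : {c ℓ : Level} (K : Field c ℓ) → FieldTheory.CharZero K →
    (m : ℕ) → 2 ≤ m → (T : FieldTheory.Poly K) → (Q : Fin m → FieldTheory.Poly K) →
    ((∃ λ S → FieldTheory.DegEq K T S
        × (∀ j → suc (toℕ j) ≡ m → FieldTheory.DegEq K (Q j) (suc S))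
        × (∀ j → suc (toℕ j) < m → FieldTheory.DegLt K (Q j) (suc S)))
     ⊎
     (∃ λ r → (∀ j → suc (toℕ j) ≡ m → FieldTheory.DegEq K (Q j) r)
        × FieldTheory.DegEq K T (suc r)
        × (∀ j → FieldTheory.DegLt K (Q j) (suc r)))) →
    FieldTheory.Irreducible K (FieldTheory.opE K m T Q)
corollary4p2 K _ m 2≤m T Q (inj₁ (S , T-S , Qₘ-1+S , Q<1+S)) =
  Equation.irreducible-degQₘ≡1+degT K m T Q (ℕP.<⇒≤ 2≤m) S T-S Qₘ-1+S Q<1+S
corollary4p2 K _ m 2≤m T Q (inj₂ (r , Qₘ-r , T-1+r , Q<1+r)) =
  Equation.irreducible-degT≡1+degQₘ K m T Q 2≤m r Qₘ-r T-1+r Q<1+r
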